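{- For every variable $x$, term $M$ and substitution $\sigma$: $x \in \mathrm{fv}(M\bullet\sigma)$ if and only if there exists $y\in\mathrm{fv}\,M$ with $x\in\mathrm{fv}(\sigma\,y)$.
   Context: Let $\mathcal{V}$ (the variables) be a type with decidable equality, together with functions $\mathrm{encode}:\mathcal{V}\to\mathbb{N}$ and $\mathrm{decode}:\mathbb{N}\to\mathcal{V}$ such that $\mathrm{encode}(\mathrm{decode}\,n)=n$ for all $n$. Let $\mathcal{C}$ (the constants) be any type. Terms $\Lambda$ are generated by: $\mathsf{c}\,k$ ($k\in\mathcal{C}$), $\mathsf{v}\,x$ ($x\in\mathcal{V}$), $\lambda[x:A]M$, $\Pi[x:A]B$, and $M\cdot N$. The list of free variables: $\mathrm{fv}(\mathsf{c}\,k)=[\,]$, $\mathrm{fv}(\mathsf{v}\,x)=[x]$, $\mathrm{fv}(\lambda[x:A]M)=\mathrm{fv}\,A \mathbin{++} (\mathrm{fv}\,M - x)$, $\mathrm{fv}(\Pi[x:A]B)=\mathrm{fv}\,A \mathbin{++} (\mathrm{fv}\,B - x)$, $\mathrm{fv}(M\cdot N)=\mathrm{fv}\,M\mathbin{++}\mathrm{fv}\,N$, where $xs-x$ deletes every occurrence of $x$. A substitution is a function $\sigma:\mathcal{V}\to\Lambda$; $(\sigma,x:=N)$ maps $x$ to $N$ and any $y\neq x$ to $\sigma\,y$. Fix $\chi':\mathrm{List}\,\mathbb{N}\to\mathbb{N}$ with $\chi'(ns)\notin ns$ for all $ns$; let $X'(xs)=\mathrm{decode}(\chi'(\mathrm{map}\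 \mathrm{encode}\ xs))$ and $X(\sigma,xs)=X'$ of the concatenation of the lists $\mathrm{fv}(\sigma\,y)$ for $y$ in $xs$. Substitution $M\bullet\sigma$ is defined by structural recursion: $\mathsf{c}\,k\bullet\sigma=\mathsf{c}\,k$; $\mathsf{v}\,x\bullet\sigma=\sigma\,x$; $(M\cdot N)\bullet\sigma=(M\bullet\sigma)\cdot(N\bullet\sigma)$; $(\lambda[x:A]M)\bullet\sigma=\lambda[y:A\bullet\sigma](M\bullet(\sigma,x:=\mathsf{v}\,y))$ where $y=X(\sigma,\mathrm{fv}\,M-x)$; $(\Pi[x:A]B)\bullet\sigma=\Pi[y:A\bullet\sigma](B\bullet(\sigma,x:=\mathsf{v}\,y))$ where $y=X(\sigma,\mathrm{fv}\,B-x)$. -}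

module Defs where

open import Data.Nat using (ℕ)
open import Data.List using (List; []; _∷_; _++_; map; concatMap; filter)
open import Data.List.Membership.Propositional using (_∈_)
open import Relation.Binary.PropositionalEquality using (_≡_)
open import Relation.Binary.Definitions using (DecidableEquality)
open import Relation.Nullary using (¬_; does)
open import Relation.Nullary.Decidable using (¬?)
open import Data.Bool using (if_then_else_)

module Lambda
  (V : Set) (_≟_ : DecidableEquality V)
  (encode : V → ℕ) (decode : ℕ → V)
  (encode-decode : ∀ n → encode (decode n) ≡ n)
  (C : Set)
  (χ' : List ℕ → ℕ) (χ'-fresh : ∀ ns → ¬ (χ' ns ∈ ns))
  where

  data Λ : Set where
    c   : C → Λ
    v   : V → Λ
    lam : V → Λ → Λ → Λ   -- λ[x:A]M  is  lam x A M
    pi  : V → Λ → Λ → Λ   -- Π[x:A]B  is  pi x A B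
    _·_ : Λ → Λ → Λ

  _-_ : List V → V → List V
  xs - x = filter (λ y → ¬? (y ≟ x)) xs

  fv : Λ → List V
  fv (c k) = []
  fv (v x) = x ∷ []
  fv (lam x A M) = fv A ++ (fv M - x)
  fv (pi x A B) = fv A ++ (fv B - x)
  fv (M · N) = fv M ++ fv N

  Subst : Set
  Subst = V → Λ

  _,_:=_ : Subst → V → Λ → Subst
  (σ , x := N) y = if does (y ≟ x) then N else σ y

  X' : List V → V
  X' xs = decode (χ' (map encode xs))

  X : Subst → List V → V
  X σ xs = X' (concatMap (λ y → fv (σ y)) xs)

  _•_ : Λ → Subst → Λ
  c k • σ = c k
  v x • σ = σ x
  (M · N) • σ = (M • σ) · (N • σ)
  lam x A M • σ =
    let y = X σ (fv M - x) in lam y (A • σ) (M • (σ , x := v y))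
  pi x A B • σ =
    let y = X σ (fv B - x) in pi y (A • σ) (B • (σ , x := v y))

-- Under a binder x
-- the new bound variable X σ (fv M - x) lies outside every fv (σ y) with y free in the
-- body, so deleting it from the body's free variables removes exactly the contribution
-- of x (which σ , x := v _ maps to that variable) and nothing that σ brings in.
module Submission where

open import Defs
open import Data.Nat using (ℕ)
open import Data.List using (List; _++_; map)
open import Data.List.Membership.Propositional using (_∈_; _∉_; lose)
open import Data.List.Membership.Propositional.Properties
  using (∈-map⁺; ∈-concatMap⁺; ∈-filter⁺; ∈-filter⁻; ++-∈⇔; ∈-++⁻; ∈-++⁺ˡ; ∈-++⁺ʳ)
open import Data.List.Relation.Unary.Any using (here)
open import Data.List.Relation.Unary.Any.Properties using (singleton⁻)
open import Data.Product using (Σ; _×_; _,_)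
open import Data.Sum using (_⊎_; inj₁; inj₂)
open import Data.Sum.Function.Propositional using (_⊎-⇔_)
open import Data.Empty using (⊥-elim)
open import Relation.Binary.PropositionalEquality using (_≡_; _≢_; refl; sym; subst)
open import Relation.Binary.Definitions using (DecidableEquality)
open import Relation.Nullary using (¬_; yes; no)
open import Relation.Nullary.Decidable using (¬?)
open import Function.Bundles using (_⇔_; mk⇔; Equivalence)
open import Function.Construct.Composition using (_⇔-∘_)
open import Function.Construct.Symmetry using (⇔-sym)

module FreeVariablesOfSubstitution
  (V : Set) (_≟_ : DecidableEquality V)
  (encode : V → ℕ) (decode : ℕ → V)
  (encode-decode : ∀ n → encode (decode n) ≡ n)
  (C : Set)
  (χ' : List ℕ → ℕ) (χ'-fresh : ∀ ns → ¬ (χ' ns ∈ ns)) where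

  open Lambda V _≟_ encode decode encode-decode C χ' χ'-fresh

  FreeIn : Subst → List V → V → Set
  FreeIn σ xs x = Σ V (λ y → (y ∈ xs) × (x ∈ fv (σ y)))

  X'-fresh : ∀ xs → X' xs ∉ xs
  X'-fresh xs X'∈xs =
    χ'-fresh ns (subst (_∈ ns) (encode-decode (χ' ns)) (∈-map⁺ encode X'∈xs))
    where ns = map encode xs

  X-fresh : ∀ σ xs → ¬ FreeIn σ xs (X σ xs)
  X-fresh σ xs (y , y∈xs , X∈σy) =
    X'-fresh _ (∈-concatMap⁺ (λ z → fv (σ z)) (lose y∈xs X∈σy))

  ∈-delete⁺ : ∀ {x z xs} → x ∈ xs → x ≢ z → x ∈ xs - z
  ∈-delete⁺ {z = z} = ∈-filter⁺ (λ w → ¬? (w ≟ z))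

  ∈-delete⁻ : ∀ {x z xs} → x ∈ xs - z → x ∈ xs × x ≢ z
  ∈-delete⁻ {z = z} = ∈-filter⁻ (λ w → ¬? (w ≟ z))

  update-≢ : ∀ σ {z w} N → w ≢ z → (σ , z := N) w ≡ σ w
  update-≢ σ {z} {w} N w≢z with w ≟ z
  ... | yes w≡z = ⊥-elim (w≢z w≡z)
  ... | no _    = refl

  FreeIn-++ : ∀ σ xs {ys x} → FreeIn σ (xs ++ ys) x ⇔ (FreeIn σ xs x ⊎ FreeIn σ ys x)
  FreeIn-++ σ xs = mk⇔ to from
    where
    to : ∀ {ys x} → FreeIn σ (xs ++ ys) x → FreeIn σ xs x ⊎ FreeIn σ ys x
    to (y , y∈ , x∈σy) with ∈-++⁻ xs y∈
    ... | inj₁ y∈xs = inj₁ (y , y∈xs , x∈σy)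
    ... | inj₂ y∈ys = inj₂ (y , y∈ys , x∈σy)

    from : ∀ {ys x} → FreeIn σ xs x ⊎ FreeIn σ ys x → FreeIn σ (xs ++ ys) x
    from (inj₁ (y , y∈xs , x∈σy)) = y , ∈-++⁺ˡ y∈xs , x∈σy
    from (inj₂ (y , y∈ys , x∈σy)) = y , ∈-++⁺ʳ xs y∈ys , x∈σy

  FreeIn-++-cong : ∀ σ {as bs xs ys} →
    (∀ {x} → x ∈ as ⇔ FreeIn σ xs x) → (∀ {x} → x ∈ bs ⇔ FreeIn σ ys x) →
    ∀ {x} → x ∈ as ++ bs ⇔ FreeIn σ (xs ++ ys) x
  FreeIn-++-cong σ {xs = xs} as⇔ bs⇔ =
    ⇔-sym (FreeIn-++ σ xs) ⇔-∘ ((as⇔ ⊎-⇔ bs⇔) ⇔-∘ ++-∈⇔)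

  FreeIn-rename-binder : ∀ {σ z y ms ns} → ¬ FreeIn σ (ms - z) y →
    (∀ {x} → x ∈ ns ⇔ FreeIn (σ , z := v y) ms x) →
    ∀ {x} → x ∈ ns - y ⇔ FreeIn σ (ms - z) x
  FreeIn-rename-binder {σ} {z} {y} {ms} {ns} y-fresh fv-ns = mk⇔ to from
    where
    to : ∀ {x} → x ∈ ns - y → FreeIn σ (ms - z) x
    to x∈ns-y with ∈-delete⁻ x∈ns-y
    ... | x∈ns , x≢y with Equivalence.to fv-ns x∈ns
    ...   | w , w∈ms , x∈σ'w with w ≟ z
    -- matching on w ≟ z also evaluates the update at w in the type of x∈σ'w
    ...     | yes refl = ⊥-elim (x≢y (singleton⁻ x∈σ'w))
    ...     | no w≢z = w , ∈-delete⁺ w∈ms w≢z , x∈σ'w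

    from : ∀ {x} → FreeIn σ (ms - z) x → x ∈ ns - y
    from {x} (w , w∈ms-z , x∈σw) with ∈-delete⁻ w∈ms-z
    ... | w∈ms , w≢z = ∈-delete⁺ (Equivalence.from fv-ns (w , w∈ms , x∈σ'w)) x≢y
      where
      x∈σ'w : x ∈ fv ((σ , z := v y) w)
      x∈σ'w = subst (λ t → x ∈ fv t) (sym (update-≢ σ (v y) w≢z)) x∈σw

      x≢y : x ≢ y
      x≢y refl = y-fresh (w , w∈ms-z , x∈σw)

  fv-• : ∀ M σ {x} → x ∈ fv (M • σ) ⇔ FreeIn σ (fv M) x
  fv-• (c k)       σ = mk⇔ (λ ()) (λ ())
  fv-• (v y)       σ = mk⇔ (λ x∈σy → y , here refl , x∈σy) (λ { (_ , here refl , x∈σy) → x∈σy })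
  fv-• (M · N)     σ = FreeIn-++-cong σ (fv-• M σ) (fv-• N σ)
  fv-• (lam z A M) σ =
    FreeIn-++-cong σ (fv-• A σ) (FreeIn-rename-binder (X-fresh σ (fv M - z)) (fv-• M _))
  fv-• (pi z A B)  σ =
    FreeIn-++-cong σ (fv-• A σ) (FreeIn-rename-binder (X-fresh σ (fv B - z)) (fv-• B _))

lemma5 : (V : Set) (_≟_ : DecidableEquality V)
    (encode : V → ℕ) (decode : ℕ → V)
    (encode-decode : ∀ n → encode (decode n) ≡ n)
    (C : Set)
    (χ' : List ℕ → ℕ) (χ'-fresh : ∀ ns → ¬ (χ' ns ∈ ns)) →
    let open Lambda V _≟_ encode decode encode-decode C χ' χ'-fresh in
    (x : V) (M : Λ) (σ : Subst) →
    (x ∈ fv (M • σ)) ⇔ Σ V (λ y → (y ∈ fv M) × (x ∈ fv (σ y)))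
lemma5 V _≟_ encode decode encode-decode C χ' χ'-fresh x M σ =
  fv-• M σ
  where open FreeVariablesOfSubstitution V _≟_ encode decode encode-decode C χ' χ'-fresh
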